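{- Let $A,B\in\mathbb{R}^2$ be vectors of equal length making an angle of $60^\circ$, let $\Lambda=\mathbb{Z}A+\mathbb{Z}B$, let $r_1$ be the reflection in the line $\mathbb{R}A$ and $r_2$ the reflection in the line $\mathbb{R}(A-B)$. For every positive integer $n$, the number of subgroups $K\le \Lambda$ of index $n$ with $r_1(K)=K$ and $r_2(K)=K$ equals $$f_5(n)=\begin{cases}0,&\text{if } v_p(n)\text{ is odd for some prime } p\neq 3,\\ 1,&\text{otherwise,}\end{cases}$$ where $v_p(n)$ is the exponent of the prime $p$ in $n$.
   Context: An $n$-sheeted toroidal cover $X=E/K$ of the minimal toroidal map $E/\Lambda$ of a plane tiling $E$ with translation lattice $\Lambda$ corresponds to a subgroup $K\le\Lambda$ of index $n$; a symmetry of $E$ fixing the origin belongs to $\mathrm{Aut}(X)$ iff its linear part maps $K$ onto itself. The lemma counts the $n$-sheeted covers whose automorphism group contains both reflections $r_1,r_2$. -}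

module Defs where

open import Level using (0ℓ)
open import Data.Nat as ℕ using (ℕ; suc; _^_)
open import Data.Nat.Divisibility using (_∣_)
open import Data.Nat.Primality using (Prime)
open import Data.Integer as ℤ using (ℤ)
open import Data.Fin using (Fin)
open import Data.Product using (Σ; _×_; _,_; ∃)
open import Relation.Nullary using (¬_)
open import Relation.Binary.PropositionalEquality using (_≡_; _≢_)
open import Function.Bundles using (_⇔_)

-- The lattice Λ = ℤA + ℤB, written in the basis (A , B): (a , b) ↦ aA + bB.
Λ : Set
Λ = ℤ × ℤ

0Λ : Λ
0Λ = ℤ.0ℤ , ℤ.0ℤ

_+Λ_ : Λ → Λ → Λ
(a , b) +Λ (c , d) = (a ℤ.+ c) , (b ℤ.+ d)

-Λ_ : Λ → Λ
-Λ (a , b) = ℤ.- a , ℤ.- b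

_-Λ_ : Λ → Λ → Λ
x -Λ y = x +Λ (-Λ y)

-- Linear parts of the reflections in these coordinates
-- (|A| = |B|, angle 60°):  r₁(A) = A, r₁(B) = A - B ;  r₂(A) = -B, r₂(B) = -A.
r₁ : Λ → Λ
r₁ (a , b) = (a ℤ.+ b) , ℤ.- b

r₂ : Λ → Λ
r₂ (a , b) = ℤ.- b , ℤ.- a

SubsetΛ : Set₁
SubsetΛ = Λ → Set

record IsSubgroup (K : SubsetΛ) : Set where
  field
    has-0   : K 0Λ
    closed+ : ∀ {x y} → K x → K y → K (x +Λ y)
    closed- : ∀ {x} → K x → K (-Λ x)

HasIndex : SubsetΛ → ℕ → Set
HasIndex K n =
  Σ (Fin n → Λ) λ c → ∀ x →
    Σ (Fin n) λ i → K (x -Λ c i) × (∀ j → K (x -Λ c j) → j ≡ i)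

Preserves : (Λ → Λ) → SubsetΛ → Set
Preserves r K = (∀ x → K x → K (r x)) × (∀ y → K y → Σ Λ λ x → K x × r x ≡ y)

_≐_ : SubsetΛ → SubsetΛ → Set
K ≐ L = ∀ x → K x ⇔ L x

CountIs : (SubsetΛ → Set) → ℕ → Set₁
CountIs P m =
  Σ (Fin m → SubsetΛ) λ L →
    (∀ i → P (L i)) ×
    (∀ i j → L i ≐ L j → i ≡ j) ×
    (∀ K → P K → Σ (Fin m) λ i → K ≐ L i)

Counted : ℕ → SubsetΛ → Set
Counted n K = IsSubgroup K × HasIndex K n × Preserves r₁ K × Preserves r₂ K

OddValuation : ℕ → ℕ → Set
OddValuation p n = ∃ λ k → (p ^ (1 ℕ.+ 2 ℕ.* k)) ∣ n × ¬ ((p ^ (2 ℕ.+ 2 ℕ.* k)) ∣ n)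

-- f₅(n) = 0 if v_p(n) odd for some prime p ≠ 3, else 1.
BadN : ℕ → Set
BadN n = ∃ λ p → Prime p × p ≢ 3 × OddValuation p n

module Submission where

-- Let K ≤ Λ have index n and be fixed by r₁ and r₂, and let a and g be the orders of A and of
-- A + B modulo K. For v = (x, y) ∈ K both v + r₁ v and w + r₁ w, where w = r₁ (r₂ v), lie on ℤA,
-- whence a ∣ y − x and a ∣ 3x; with (0, a) = −r₂ (a, 0) ∈ K this gives
-- K = {xA + yB : g ∣ x, a ∣ y − x} with g ∣ a ∣ 3g, so a = t g with t ∈ {1, 3} and n = t g².
-- Conversely each such lattice is invariant of index t g², and as g² ≠ 3h² the pair (t, g) is
-- determined by n. Finally n = t g² with t ∣ 3 exactly when v_p(n) is even for all primes p ≠ 3.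

open import Defs

module SquareClasses where
  open import Data.Nat as ℕ using (ℕ; zero; suc; NonZero; _+_; _*_; _^_; _<_; _≤_; s≤s; z≤n)
  import Data.Nat.Properties as ℕₚ
  open import Data.Nat.Divisibility
  open import Data.Nat.Primality
  open import Data.Nat.Induction using (<-rec)
  open import Data.Nat.Tactic.RingSolver using (solve-∀)
  open import Data.Nat.ListAction using (product)
  open import Data.Nat.Primality.Factorisation using (factorise)
  open import Data.List using ([]; _∷_)
  open import Data.List.Relation.Unary.All using (_∷_)
  open import Data.Product using (∃; ∃₂; _×_; _,_)
  open import Data.Sum using (_⊎_; inj₁; inj₂)
  open import Data.Empty using (⊥-elim)
  open import Relation.Nullary using (¬_; yes; no)
  open import Relation.Nullary.Decidable using (toWitness)
  open import Relation.Binary.PropositionalEquality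
  open import Relation.Binary.Definitions using (tri<; tri≈; tri>)

  prime[3] : Prime 3
  prime[3] = toWitness {a? = prime? 3} _

  prime≢1 : ∀ {p} → Prime p → p ≢ 1
  prime≢1 (prime ⦃ p>1 ⦄ _) = ℕ.nonTrivial⇒≢1 ⦃ p>1 ⦄

  prime∣prime⇒≡ : ∀ {p q} → Prime p → Prime q → p ∣ q → p ≡ q
  prime∣prime⇒≡ pp pq p∣q with prime⇒irreducible pq p∣q
  ... | inj₁ p≡1 = ⊥-elim (prime≢1 pp p≡1)
  ... | inj₂ p≡q = p≡q

  ∣3⇒≡1∨≡3 : ∀ {t} → t ∣ 3 → t ≡ 1 ⊎ t ≡ 3
  ∣3⇒≡1∨≡3 = prime⇒irreducible prime[3]

  prime∣square⇒∣ : ∀ {p} → Prime p → ∀ D → p ∣ D * D → p ∣ D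
  prime∣square⇒∣ pp D p∣D² with euclidsLemma D D pp p∣D²
  ... | inj₁ p∣D = p∣D
  ... | inj₂ p∣D = p∣D

  p^j∣c*m⇒p^j∣m : ∀ {p c m} → Prime p → ¬ p ∣ c → ∀ j → p ^ j ∣ c * m → p ^ j ∣ m
  p^j∣c*m⇒p^j∣m {p} {c} {m} pp p∤c zero _ = 1∣ m
  p^j∣c*m⇒p^j∣m {p} {c} {m} pp p∤c (suc j) p^j⁺∣cm
    with euclidsLemma c m pp (∣-trans (m∣m*n (p ^ j)) p^j⁺∣cm)
  ... | inj₁ p∣c = ⊥-elim (p∤c p∣c)
  ... | inj₂ (divides m′ refl) =
    subst (p * p ^ j ∣_) (ℕₚ.*-comm p m′)
      (*-monoʳ-∣ p (p^j∣c*m⇒p^j∣m pp p∤c j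
        (*-cancelˡ-∣ p ⦃ prime⇒nonZero pp ⦄ (subst (p * p ^ j ∣_) (reorder c m′ p) p^j⁺∣cm))))
    where
    reorder : ∀ c m′ p → c * (m′ * p) ≡ p * (c * m′)
    reorder = solve-∀

  2*-suc : ∀ i k → i + 2 * suc k ≡ 2 + (i + 2 * k)
  2*-suc = solve-∀

  [D*p]²≡p*[p*D²] : ∀ D p → D * p * (D * p) ≡ p * (p * (D * D))
  [D*p]²≡p*[p*D²] = solve-∀

  module _ {p : ℕ} (pp : Prime p) where
    private instance
      p≢0 : NonZero p
      p≢0 = prime⇒nonZero pp

    p^j∣D²⇒p^[2+j]∣[D*p]² : ∀ j D → p ^ j ∣ D * D → p ^ (2 + j) ∣ D * p * (D * p)
    p^j∣D²⇒p^[2+j]∣[D*p]² j D h =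
      subst (p ^ (2 + j) ∣_) (sym ([D*p]²≡p*[p*D²] D p)) (*-monoʳ-∣ p (*-monoʳ-∣ p h))

    p^[2+j]∣[D*p]²⇒p^j∣D² : ∀ j D → p ^ (2 + j) ∣ D * p * (D * p) → p ^ j ∣ D * D
    p^[2+j]∣[D*p]²⇒p^j∣D² j D h =
      *-cancelˡ-∣ p (*-cancelˡ-∣ p (subst (p ^ (2 + j) ∣_) ([D*p]²≡p*[p*D²] D p) h))

    p^[1+2k]∣D²⇒p^[2+2k]∣D² : ∀ k D → p ^ (1 + 2 * k) ∣ D * D → p ^ (2 + 2 * k) ∣ D * D
    p^[1+2k]∣D²⇒p^[2+2k]∣D² k D h with prime∣square⇒∣ pp D (∣-trans (m∣m*n (p ^ (2 * k))) h)
    p^[1+2k]∣D²⇒p^[2+2k]∣D² zero    _ h | divides D′ refl = p^j∣D²⇒p^[2+j]∣[D*p]² 0 D′ (1∣ _)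
    p^[1+2k]∣D²⇒p^[2+2k]∣D² (suc k) _ h | divides D′ refl =
      subst (λ j → p ^ j ∣ D′ * p * (D′ * p)) (sym (2*-suc 2 k))
        (p^j∣D²⇒p^[2+j]∣[D*p]² (2 + 2 * k) D′ (p^[1+2k]∣D²⇒p^[2+2k]∣D² k D′
          (p^[2+j]∣[D*p]²⇒p^j∣D² (1 + 2 * k) D′ (subst (λ j → p ^ j ∣ D′ * p * (D′ * p)) (2*-suc 1 k) h))))

    ¬OddValuation[c*D²] : ∀ {c} → ¬ p ∣ c → ∀ D → ¬ OddValuation p (c * (D * D))
    ¬OddValuation[c*D²] {c} p∤c D (k , odd∣ , ¬even∣) =
      ¬even∣ (∣n⇒∣m*n c (p^[1+2k]∣D²⇒p^[2+2k]∣D² k D (p^j∣c*m⇒p^j∣m pp p∤c (1 + 2 * k) odd∣)))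

    OddValuation-*ˡ : ∀ {c m} → ¬ p ∣ c → OddValuation p m → OddValuation p (c * m)
    OddValuation-*ˡ {c} p∤c (k , odd∣ , ¬even∣) =
      k , ∣n⇒∣m*n c odd∣ , λ h → ¬even∣ (p^j∣c*m⇒p^j∣m pp p∤c (2 + 2 * k) h)

    OddValuation-p*p* : ∀ {m} → OddValuation p m → OddValuation p (p * (p * m))
    OddValuation-p*p* {m} (k , odd∣ , ¬even∣) =
      suc k ,
      subst (λ j → p ^ j ∣ p * (p * m)) (sym (2*-suc 1 k)) (*-monoʳ-∣ p (*-monoʳ-∣ p odd∣)) ,
      λ h → ¬even∣ (*-cancelˡ-∣ p (*-cancelˡ-∣ p (subst (λ j → p ^ j ∣ p * (p * m)) (2*-suc 2 k) h)))

  prime≢3⇒∤[t∣3] : ∀ {p t} → Prime p → p ≢ 3 → t ∣ 3 → ¬ p ∣ t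
  prime≢3⇒∤[t∣3] pp p≢3 t∣3 p∣t = p≢3 (prime∣prime⇒≡ pp prime[3] (∣-trans p∣t t∣3))

  ¬BadN[t*D²] : ∀ {t} → t ∣ 3 → ∀ D → ¬ BadN (t * (D * D))
  ¬BadN[t*D²] t∣3 D (p , pp , p≢3 , odd) = ¬OddValuation[c*D²] pp (prime≢3⇒∤[t∣3] pp p≢3 t∣3) D odd

  BadN-3* : ∀ {m} → BadN m → BadN (3 * m)
  BadN-3* (p , pp , p≢3 , odd) = p , pp , p≢3 , OddValuation-*ˡ pp (prime≢3⇒∤[t∣3] pp p≢3 ∣-refl) odd

  BadN-p*p* : ∀ {p m} → Prime p → BadN m → BadN (p * (p * m))
  BadN-p*p* {p} {m} pp (q , pq , q≢3 , odd) with q ℕ.≟ p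
  ... | yes refl = q , pq , q≢3 , OddValuation-p*p* pq odd
  ... | no q≢p = q , pq , q≢3 , subst (OddValuation q) (ℕₚ.*-assoc p p m) (OddValuation-*ˡ pq q∤p*p odd)
    where
    q∤p*p : ¬ q ∣ p * p
    q∤p*p q∣p*p = q≢p (prime∣prime⇒≡ pq pp (prime∣square⇒∣ pq p q∣p*p))

  n<3^n : ∀ n → n < 3 ^ n
  n<3^n zero    = s≤s z≤n
  n<3^n (suc n) = ℕₚ.≤-<-trans (n<3^n n)
    (subst (3 ^ n <_) (ℕₚ.*-comm (3 ^ n) 3) (ℕₚ.m<m*n (3 ^ n) 3 ⦃ ℕₚ.m^n≢0 3 n ⦄ (s≤s (s≤s z≤n))))

  ∀3^[1+2k]∣⇒≡0 : ∀ {x} → (∀ k → 3 ^ (1 + 2 * k) ∣ x) → x ≡ 0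
  ∀3^[1+2k]∣⇒≡0 {zero}  _   = refl
  ∀3^[1+2k]∣⇒≡0 {suc x} all∣ = ⊥-elim (ℕₚ.<⇒≱ (ℕₚ.<-≤-trans (n<3^n (suc x)) 3^x≤3^[1+2x]) (∣⇒≤ (all∣ (suc x))))
    where
    3^x≤3^[1+2x] : 3 ^ suc x ≤ 3 ^ (1 + 2 * suc x)
    3^x≤3^[1+2x] = ℕₚ.^-monoʳ-≤ 3 (ℕₚ.m≤n⇒m≤1+n (ℕₚ.m≤m+n (suc x) _))

  square≢3*square : ∀ D E → .{{NonZero D}} → D * D ≢ 3 * (E * E)
  square≢3*square D E eq = ℕ.≢-nonZero⁻¹ (D * D) ⦃ ℕₚ.m*n≢0 D D ⦄ (∀3^[1+2k]∣⇒≡0 3^[1+2k]∣D²)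
    where
    3^[1+2k]∣D² : ∀ k → 3 ^ (1 + 2 * k) ∣ D * D
    3^[1+2k]∣D² zero    = subst (3 ∣_) (sym eq) (m∣m*n (E * E))
    -- 3^(1+2k) ∣ D² forces 3^(2+2k) ∣ D² = 3E², so 3^(1+2k) ∣ E², hence 3^(2+2k) ∣ E².
    3^[1+2k]∣D² (suc k) =
      subst (λ j → 3 ^ j ∣ D * D) (sym (2*-suc 1 k))
        (subst (3 ^ (3 + 2 * k) ∣_) (sym eq)
          (*-monoʳ-∣ 3 (p^[1+2k]∣D²⇒p^[2+2k]∣D² prime[3] k E
            (*-cancelˡ-∣ 3 (subst (3 ^ (2 + 2 * k) ∣_) eq (p^[1+2k]∣D²⇒p^[2+2k]∣D² prime[3] k D (3^[1+2k]∣D² k)))))))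

  SquareOrThriceSquare : ℕ → Set
  SquareOrThriceSquare n = ∃₂ λ t D → t ∣ 3 × n ≡ t * (D * D)

  SquareOrThriceSquare-*p² : ∀ {m} p → SquareOrThriceSquare m → SquareOrThriceSquare (m * (p * p))
  SquareOrThriceSquare-*p² p (t , D , t∣3 , refl) = t , D * p , t∣3 , reorder t D p
    where
    reorder : ∀ t D p → t * (D * D) * (p * p) ≡ t * (D * p * (D * p))
    reorder = solve-∀

  SquareOrThriceSquare-*3 : ∀ {m} → ¬ 9 ∣ m * 3 → SquareOrThriceSquare m → SquareOrThriceSquare (m * 3)
  SquareOrThriceSquare-*3 ¬9∣ (t , D , t∣3 , refl) with ∣3⇒≡1∨≡3 t∣3
  ... | inj₁ refl = 3 , D , ∣-refl , reorder D
    where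
    reorder : ∀ D → 1 * (D * D) * 3 ≡ 3 * (D * D)
    reorder = solve-∀
  ... | inj₂ refl = ⊥-elim (¬9∣ (divides (D * D) (reorder D)))
    where
    reorder : ∀ D → 3 * (D * D) * 3 ≡ D * D * 9
    reorder = solve-∀

  prime-divisor : ∀ n → .{{NonZero n}} → n ≢ 1 → ∃ λ p → Prime p × p ∣ n
  prime-divisor n n≢1 with factorise n
  ... | record { factors = [] ; isFactorisation = n≡1 } = ⊥-elim (n≢1 n≡1)
  ... | record { factors = p ∷ ps ; isFactorisation = n≡ ; factorsPrime = pp ∷ _ } =
    p , pp , divides (product ps) (trans n≡ (ℕₚ.*-comm p (product ps)))

  ¬BadN⇒SquareOrThriceSquare : ∀ n → .{{NonZero n}} → ¬ BadN n → SquareOrThriceSquare n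
  ¬BadN⇒SquareOrThriceSquare = <-rec P reduce
    where
    P : ℕ → Set
    P n = .{{NonZero n}} → ¬ BadN n → SquareOrThriceSquare n

    cofactor : ∀ m d → .{{NonZero (m * d)}} → 1 < d → NonZero m × m < m * d
    cofactor m d 1<d = let instance m≢0 = ℕₚ.m*n≢0⇒m≢0 m in m≢0 , ℕₚ.m<m*n m d 1<d

    reduce : ∀ n → (∀ {m} → m < n → P m) → P n
    reduce n ih ¬bad with n ℕ.≟ 1
    ... | yes refl = 1 , 1 , 1∣ 3 , refl
    ... | no n≢1 with prime-divisor n n≢1
    ...   | p , pp , p∣n with (p * p) ∣? n
    ...     | yes (divides m refl) =
      let m≢0 , m<n = cofactor m (p * p) (ℕₚ.*-mono-≤ 1<p (ℕₚ.<⇒≤ 1<p)) in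
      SquareOrThriceSquare-*p² p (ih m<n ⦃ m≢0 ⦄ λ bad → ¬bad (subst BadN (reorder p m) (BadN-p*p* pp bad)))
      where
      1<p : 1 < p
      1<p = ℕ.nonTrivial⇒n>1 p ⦃ prime⇒nonTrivial pp ⦄
      reorder : ∀ p m → p * (p * m) ≡ m * (p * p)
      reorder = solve-∀
    ...     | no p²∤n with p ℕ.≟ 3
    ...       | no p≢3 = ⊥-elim (¬bad (p , pp , p≢3 , 0 ,
                   subst (_∣ n) (sym (ℕₚ.*-identityʳ p)) p∣n ,
                   λ p²∣n → p²∤n (subst (_∣ n) (cong (p *_) (ℕₚ.*-identityʳ p)) p²∣n)))
    ...       | yes refl with p∣n
    ...         | divides m refl =
      let m≢0 , m<n = cofactor m 3 (s≤s (s≤s z≤n)) in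
      SquareOrThriceSquare-*3 p²∤n (ih m<n ⦃ m≢0 ⦄ λ bad → ¬bad (subst BadN (ℕₚ.*-comm 3 m) (BadN-3* bad)))

  square-injective : ∀ {m n} → m * m ≡ n * n → m ≡ n
  square-injective {m} {n} eq with ℕₚ.<-cmp m n
  ... | tri< m<n _ _ = ⊥-elim (ℕₚ.<-irrefl eq (ℕₚ.*-mono-< m<n m<n))
  ... | tri≈ _ m≡n _ = m≡n
  ... | tri> _ _ n<m = ⊥-elim (ℕₚ.<-irrefl (sym eq) (ℕₚ.*-mono-< n<m n<m))

  t*D²-injective : ∀ {t t′ D E} → .{{NonZero D}} → t ∣ 3 → t′ ∣ 3 →
                   t * (D * D) ≡ t′ * (E * E) → t ≡ t′ × D ≡ E
  t*D²-injective {t} {t′} {D} {E} t∣3 t′∣3 eq with ∣3⇒≡1∨≡3 t∣3 | ∣3⇒≡1∨≡3 t′∣3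
  ... | inj₁ refl | inj₁ refl =
    refl , square-injective (trans (sym (ℕₚ.*-identityˡ (D * D))) (trans eq (ℕₚ.*-identityˡ (E * E))))
  ... | inj₂ refl | inj₂ refl = refl , square-injective (ℕₚ.*-cancelˡ-≡ (D * D) (E * E) 3 eq)
  ... | inj₁ refl | inj₂ refl = ⊥-elim (square≢3*square D E (trans (sym (ℕₚ.*-identityˡ (D * D))) eq))
  ... | inj₂ refl | inj₁ refl = ⊥-elim (square≢3*square E D ⦃ E≢0 ⦄ (trans (sym (ℕₚ.*-identityˡ (E * E))) (sym eq)))
    where
    E≢0 : NonZero E
    E≢0 = ℕₚ.m*n≢0⇒m≢0 E ⦃ ℕₚ.m*n≢0⇒n≢0 1 ⦃ subst NonZero eq (ℕₚ.m*n≢0 3 (D * D) ⦃ _ ⦄ ⦃ ℕₚ.m*n≢0 D D ⦄) ⦄ ⦄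

open SquareClasses using (SquareOrThriceSquare; ¬BadN[t*D²]; ¬BadN⇒SquareOrThriceSquare; t*D²-injective)

open import Data.Nat as ℕ using (ℕ; zero; suc; NonZero; _<_; _≤_)
import Data.Nat.Properties as ℕₚ
open import Data.Nat.Divisibility as ℕ∣ using (_∣_; divides)
open import Data.Integer as ℤ using (ℤ; +_; -[1+_]; _+_; _*_; -_; _-_; 0ℤ; 1ℤ)
import Data.Integer.Properties as ℤₚ
open import Data.Integer.DivMod using (_%ℕ_; _/ℕ_; n%ℕd<d; a≡a%ℕn+[a/ℕn]*n)
open import Data.Integer.Divisibility.Signed as Signed
  using (∣m∣n⇒∣m+n; ∣m⇒∣-m; ∣n⇒∣m*n; ∣⇒∣ᵤ; ∣ᵤ⇒∣) renaming (_∣_ to _∣ℤ_)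
open import Data.Integer.Tactic.RingSolver using (solve-∀)
open import Data.Nat.Tactic.RingSolver using () renaming (solve-∀ to ℕ-solve-∀)
open import Data.Fin as Fin using (Fin; toℕ; fromℕ<; combine; remQuot)
import Data.Fin.Properties as Finₚ
open import Data.Product using (∃; ∃₂; _×_; _,_; proj₁; proj₂)
open import Data.Sum using (_⊎_; inj₁; inj₂; [_,_]; [_,_]′)
open import Function.Base using (_∘_; case_of_)
open import Data.Empty using (⊥-elim)
open import Relation.Nullary using (¬_; Dec; yes; no)
open import Relation.Nullary.Decidable using (map′)
open import Relation.Binary.PropositionalEquality hiding ([_])
open import Function.Bundles using (mk⇔; Equivalence)

infixr 7 _·_

_·_ : ℤ → Λ → Λ
m · (x , y) = m * x , m * y

-Λ-cancelʳ : ∀ x y c → (x -Λ c) -Λ (y -Λ c) ≡ x -Λ y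
-Λ-cancelʳ (x₁ , x₂) (y₁ , y₂) (c₁ , c₂) = cong₂ _,_ (lemma x₁ y₁ c₁) (lemma x₂ y₂ c₂)
  where
  lemma : ∀ x y c → (x - c) - (y - c) ≡ x - y
  lemma = solve-∀

-Λ-chain : ∀ x y z → (x -Λ y) +Λ (y -Λ z) ≡ x -Λ z
-Λ-chain (x₁ , x₂) (y₁ , y₂) (z₁ , z₂) = cong₂ _,_ (lemma x₁ y₁ z₁) (lemma x₂ y₂ z₂)
  where
  lemma : ∀ x y z → (x - y) + (y - z) ≡ x - z
  lemma = solve-∀

-Λ-identityʳ : ∀ x → x -Λ 0Λ ≡ x
-Λ-identityʳ (x₁ , x₂) = cong₂ _,_ (ℤₚ.+-identityʳ x₁) (ℤₚ.+-identityʳ x₂)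

-Λ-self : ∀ x → x -Λ x ≡ 0Λ
-Λ-self (x₁ , x₂) = cong₂ _,_ (ℤₚ.+-inverseʳ x₁) (ℤₚ.+-inverseʳ x₂)

·-suc : ∀ n v → + suc n · v ≡ v +Λ (+ n · v)
·-suc n (x , y) = cong₂ _,_ (lemma (+ n) x) (lemma (+ n) y)
  where
  lemma : ∀ n x → (1ℤ + n) * x ≡ x + n * x
  lemma = solve-∀

·-neg : ∀ m v → - m · v ≡ -Λ (m · v)
·-neg m (x , y) = cong₂ _,_ (sym (ℤₚ.neg-distribˡ-* m x)) (sym (ℤₚ.neg-distribˡ-* m y))

·-distribʳ--Λ : ∀ m k v → (m · v) -Λ (k · v) ≡ (m - k) · v
·-distribʳ--Λ m k (x , y) = cong₂ _,_ (lemma m k x) (lemma m k y)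
  where
  lemma : ∀ m k x → m * x - k * x ≡ (m - k) * x
  lemma = solve-∀

module Subgroup {K : SubsetΛ} (K-sub : IsSubgroup K) where
  open IsSubgroup K-sub public

  closed-- : ∀ {x y} → K x → K y → K (x -Λ y)
  closed-- kx ky = closed+ kx (closed- ky)

  closed-·ℕ : ∀ n {v} → K v → K (+ n · v)
  closed-·ℕ zero    _  = has-0
  closed-·ℕ (suc n) kv = subst K (sym (·-suc n _)) (closed+ kv (closed-·ℕ n kv))

  closed-· : ∀ m {v} → K v → K (m · v)
  closed-· (+ n)      kv = closed-·ℕ n kv
  closed-· -[1+ n ] kv = subst K (sym (·-neg (+ suc n) _)) (closed- (closed-·ℕ (suc n) kv))

module Cosets {K : SubsetΛ} (K-sub : IsSubgroup K) {n : ℕ} (K-idx : HasIndex K n) where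
  open Subgroup K-sub

  rep : Fin n → Λ
  rep = proj₁ K-idx

  coset : Λ → Fin n
  coset x = proj₁ (proj₂ K-idx x)

  ∈-coset : ∀ x → K (x -Λ rep (coset x))
  ∈-coset x = proj₁ (proj₂ (proj₂ K-idx x))

  coset-unique : ∀ x i → K (x -Λ rep i) → i ≡ coset x
  coset-unique x = proj₂ (proj₂ (proj₂ K-idx x))

  coset-≡⇒∈ : ∀ x y → coset x ≡ coset y → K (x -Λ y)
  coset-≡⇒∈ x y eq = subst K (-Λ-cancelʳ x y (rep (coset y)))
    (closed-- (subst (λ i → K (x -Λ rep i)) eq (∈-coset x)) (∈-coset y))

  ∈⇒coset-≡ : ∀ x y → K (x -Λ y) → coset x ≡ coset y
  ∈⇒coset-≡ x y k = sym (coset-unique x (coset y)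
    (subst K (-Λ-chain x y (rep (coset y))) (closed+ k (∈-coset y))))

  ∈? : ∀ x → Dec (K x)
  ∈? x = map′ (λ eq → subst K (-Λ-identityʳ x) (coset-≡⇒∈ x 0Λ eq))
              (λ k → ∈⇒coset-≡ x 0Λ (subst K (sym (-Λ-identityʳ x)) k))
              (coset x Fin.≟ coset 0Λ)

index-unique : ∀ {K} → IsSubgroup K → ∀ {n m} → HasIndex K n → HasIndex K m → n ≡ m
index-unique {K} K-sub Kₙ Kₘ = ℕₚ.≤-antisym (≤-index Kₙ Kₘ) (≤-index Kₘ Kₙ)
  where
  ≤-index : ∀ {n m} → HasIndex K n → HasIndex K m → n ≤ m
  ≤-index Kₙ Kₘ = Finₚ.injective⇒≤ {f = λ i → M.coset (N.rep i)} injective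
    where
    module N = Cosets K-sub Kₙ
    module M = Cosets K-sub Kₘ
    rep-coset : ∀ i → N.coset (N.rep i) ≡ i
    rep-coset i = sym (N.coset-unique (N.rep i) i
      (subst K (sym (-Λ-self (N.rep i))) (IsSubgroup.has-0 K-sub)))
    injective : ∀ {i j} → M.coset (N.rep i) ≡ M.coset (N.rep j) → i ≡ j
    injective {i} {j} eq = trans (sym (rep-coset i)) (trans
      (N.∈⇒coset-≡ (N.rep i) (N.rep j) (M.coset-≡⇒∈ (N.rep i) (N.rep j) eq)) (rep-coset j))

HasIndex-resp-≐ : ∀ {K L n} → K ≐ L → HasIndex K n → HasIndex L n
HasIndex-resp-≐ K≐L (rep , cosets) = rep , λ x →
  let i , ∈ , unique = cosets x in
  i , Equivalence.to (K≐L _) ∈ , λ j ∈ⱼ → unique j (Equivalence.from (K≐L _) ∈ⱼ)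

Least : (ℕ → Set) → ℕ → Set
Least P a = P a × (∀ {b} → b < a → ¬ P b)

module _ {P : ℕ → Set} (P? : ∀ k → Dec (P k)) where
  private
    search : ∀ k → ∃ (Least P) ⊎ (∀ {b} → b < k → ¬ P b)
    search zero = inj₂ λ ()
    search (suc k) with search k
    ... | inj₁ found = inj₁ found
    ... | inj₂ none with P? k
    ...   | yes pₖ = inj₁ (k , pₖ , none)
    ...   | no ¬pₖ = inj₂ λ b<1+k → [ none , (λ { refl → ¬pₖ }) ] (ℕₚ.m<1+n⇒m<n∨m≡n b<1+k)

  least-witness : ∀ {k} → P k → ∃ (Least P)
  least-witness {k} pₖ with search (suc k)
  ... | inj₁ found = found
  ... | inj₂ none  = ⊥-elim (none (ℕₚ.n<1+n k) pₖ)

·-sub-multiple : ∀ m q A v → (m · v) -Λ (q · (A · v)) ≡ (m - q * A) · v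
·-sub-multiple m q A (x , y) = cong₂ _,_ (lemma m q A x) (lemma m q A y)
  where
  lemma : ∀ m q A x → m * x - q * (A * x) ≡ (m - q * A) * x
  lemma = solve-∀

-- suc a is the order of v in Λ / K.
OrderOf : SubsetΛ → Λ → ℕ → Set
OrderOf K v a = K (+ suc a · v) × (∀ m → K (m · v) → + suc a ∣ℤ m)

m≡r+q*A⇒m-q*A≡r : ∀ {m} r q A → m ≡ r + q * A → m - q * A ≡ r
m≡r+q*A⇒m-q*A≡r r q A refl = lemma r q A
  where
  lemma : ∀ r q A → r + q * A - q * A ≡ r
  lemma = solve-∀

module _ {K : SubsetΛ} (K-sub : IsSubgroup K) {n : ℕ} (K-idx : HasIndex K n) (v : Λ) where
  open Subgroup K-sub
  open Cosets K-sub K-idx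

  private
    positive-multiple : ∃ λ k → K (+ suc k · v)
    positive-multiple with Finₚ.pigeonhole (ℕₚ.n<1+n n) (λ i → coset (+ toℕ i · v))
    ... | i , j , i<j , same = positive (ℕₚ.m<n⇒0<n∸m i<j) (subst (λ d → K (d · v)) j-i≡ K[j-i])
      where
      K[j-i] : K ((+ toℕ j - + toℕ i) · v)
      K[j-i] = subst K (·-distribʳ--Λ (+ toℕ j) (+ toℕ i) v)
        (coset-≡⇒∈ (+ toℕ j · v) (+ toℕ i · v) (sym same))
      j-i≡ : + toℕ j - + toℕ i ≡ + (toℕ j ℕ.∸ toℕ i)
      j-i≡ = trans (ℤₚ.[+m]-[+n]≡m⊖n (toℕ j) (toℕ i)) (ℤₚ.⊖-≥ (ℕₚ.<⇒≤ i<j))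
      positive : ∀ {d} → 0 < d → K (+ d · v) → ∃ λ k → K (+ suc k · v)
      positive {suc d} _ k = d , k

    least-divides : ∀ {a} → Least (λ k → K (+ suc k · v)) a → ∀ m → K (m · v) → + suc a ∣ℤ m
    least-divides {a} (K[a·v] , minimal) m K[m·v]
      with m %ℕ suc a | n%ℕd<d m (suc a) | a≡a%ℕn+[a/ℕn]*n m (suc a)
    ... | zero  | _   | m≡ = Signed.divides (m /ℕ suc a) (trans m≡ (ℤₚ.+-identityˡ _))
    ... | suc r | r<a | m≡ = ⊥-elim (minimal (ℕₚ.≤-pred r<a)
      (subst (λ d → K (d · v)) (m≡r+q*A⇒m-q*A≡r (+ suc r) (m /ℕ suc a) (+ suc a) m≡)
        (subst K (·-sub-multiple m (m /ℕ suc a) (+ suc a) v)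
          (closed-- K[m·v] (closed-· (m /ℕ suc a) K[a·v])))))

    least⇒order : ∃ (Least (λ k → K (+ suc k · v))) → ∃ (OrderOf K v)
    least⇒order (a , least) = a , proj₁ least , least-divides least

  order : ∃ (OrderOf K v)
  order = least⇒order (least-witness (λ k → ∈? (+ suc k · v)) {proj₁ positive-multiple} (proj₂ positive-multiple))

∣∸⇒≡ : ∀ {D r s} → r ≤ s → s < D → D ∣ s ℕ.∸ r → r ≡ s
∣∸⇒≡ {D} {r} {s} r≤s s<D D∣s-r with s ℕ.∸ r in s-r≡
... | zero  = ℕₚ.≤-antisym r≤s (ℕₚ.m∸n≡0⇒m≤n s-r≡)
... | suc _ = ⊥-elim (ℕ∣.>⇒∤ (subst (_< D) s-r≡ (ℕₚ.≤-<-trans (ℕₚ.m∸n≤m s r) s<D)) D∣s-r)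

residues-≡ : ∀ {D r s} → r < D → s < D → + D ∣ℤ + r - + s → r ≡ s
residues-≡ {D} {r} {s} r<D s<D D∣r-s = [ r≤s⇒≡ , s≤r⇒≡ ]′ (ℕₚ.≤-total r s)
  where
  D∣∣r⊖s∣ : D ∣ ℤ.∣ r ℤ.⊖ s ∣
  D∣∣r⊖s∣ = subst (λ z → D ∣ ℤ.∣ z ∣) (ℤₚ.[+m]-[+n]≡m⊖n r s) (∣⇒∣ᵤ D∣r-s)
  r≤s⇒≡ : r ≤ s → r ≡ s
  r≤s⇒≡ r≤s = ∣∸⇒≡ r≤s s<D (subst (D ∣_) (ℤₚ.∣⊖∣-≤ r≤s) D∣∣r⊖s∣)
  s≤r⇒≡ : s ≤ r → r ≡ s
  s≤r⇒≡ s≤r = sym (∣∸⇒≡ s≤r r<D (subst (D ∣_) (trans (ℤₚ.∣m⊖n∣≡∣n⊖m∣ r s) (ℤₚ.∣⊖∣-≤ s≤r)) D∣∣r⊖s∣))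

module _ (D : ℕ) .{{_ : NonZero D}} where
  residue : ℤ → Fin D
  residue x = fromℕ< (n%ℕd<d x D)

  toℕ-residue : ∀ x → toℕ (residue x) ≡ x %ℕ D
  toℕ-residue x = Finₚ.toℕ-fromℕ< (n%ℕd<d x D)

  ∣-residue : ∀ x → + D ∣ℤ x - + toℕ (residue x)
  ∣-residue x = Signed.divides (x /ℕ D) (begin
    x - + toℕ (residue x)         ≡⟨ cong (λ r → x - + r) (toℕ-residue x) ⟩
    x - + (x %ℕ D)                ≡⟨ cong (_- + (x %ℕ D)) (a≡a%ℕn+[a/ℕn]*n x D) ⟩
    + (x %ℕ D) + x /ℕ D * + D - + (x %ℕ D) ≡⟨ lemma (+ (x %ℕ D)) (x /ℕ D) (+ D) ⟩
    x /ℕ D * + D                  ∎)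
    where
    open ≡-Reasoning
    lemma : ∀ r q D → r + q * D - r ≡ q * D
    lemma = solve-∀

  residue-unique : ∀ x i → + D ∣ℤ x - + toℕ i → i ≡ residue x
  residue-unique x i D∣x-i = Finₚ.toℕ-injective (residues-≡ (Finₚ.toℕ<n i) (Finₚ.toℕ<n (residue x))
    (subst (+ D ∣ℤ_) (lemma x (+ toℕ i) (+ toℕ (residue x)))
      (Signed.∣m∣n⇒∣m-n (∣-residue x) D∣x-i)))
    where
    lemma : ∀ x i r → (x - r) - (x - i) ≡ i - r
    lemma = solve-∀

Sublattice : ℕ → ℕ → SubsetΛ
Sublattice g a (x , y) = + g ∣ℤ x × + a ∣ℤ y - x

module _ (g a : ℕ) .{{_ : NonZero g}} .{{_ : NonZero a}} where
  private
    corner : Fin g × Fin a → Λ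
    corner (i , j) = + toℕ i , + toℕ i + + toℕ j

    rep : Fin (g ℕ.* a) → Λ
    rep k = corner (remQuot a k)

    cls : Λ → Fin (g ℕ.* a)
    cls (x , y) = combine (residue g x) (residue a (y - x))

    shear : ∀ x y i j → (y - (i + j)) - (x - i) ≡ (y - x) - j
    shear = solve-∀

    member : ∀ v → Sublattice g a (v -Λ rep (cls v))
    member (x , y) = subst (λ c → Sublattice g a ((x , y) -Λ c))
      (sym (cong corner (Finₚ.remQuot-combine {g} (residue g x) (residue a (y - x)))))
      (∣-residue g x , subst (+ a ∣ℤ_) (sym (shear x y _ _)) (∣-residue a (y - x)))

    unique : ∀ v k → Sublattice g a (v -Λ rep k) → k ≡ cls v
    unique (x , y) k (g∣ , a∣) = trans (sym (Finₚ.combine-remQuot {g} a k))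
      (cong₂ combine (residue-unique g x _ g∣) (residue-unique a (y - x) _ (subst (+ a ∣ℤ_) (shear x y _ _) a∣)))

  Sublattice-index : HasIndex (Sublattice g a) (g ℕ.* a)
  Sublattice-index = rep , λ v → cls v , member v , unique v

Sublattice-subgroup : ∀ g a → IsSubgroup (Sublattice g a)
Sublattice-subgroup g a = record
  { has-0   = Signed.divides 0ℤ refl , Signed.divides 0ℤ refl
  ; closed+ = λ { {x₁ , y₁} {x₂ , y₂} (g∣x₁ , a∣y₁-x₁) (g∣x₂ , a∣y₂-x₂) →
      ∣m∣n⇒∣m+n g∣x₁ g∣x₂ , subst (+ a ∣ℤ_) (sym (+-sub x₁ y₁ x₂ y₂)) (∣m∣n⇒∣m+n a∣y₁-x₁ a∣y₂-x₂) }
  ; closed- = λ { {x , y} (g∣x , a∣y-x) →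
      ∣m⇒∣-m g∣x , subst (+ a ∣ℤ_) (sym (neg-sub x y)) (∣m⇒∣-m a∣y-x) }
  }
  where
  +-sub : ∀ x₁ y₁ x₂ y₂ → (y₁ + y₂) - (x₁ + x₂) ≡ (y₁ - x₁) + (y₂ - x₂)
  +-sub = solve-∀
  neg-sub : ∀ x y → - y - - x ≡ - (y - x)
  neg-sub = solve-∀

involution⇒Preserves : ∀ {K r} → (∀ x → r (r x) ≡ x) → (∀ {x} → K x → K (r x)) → Preserves r K
involution⇒Preserves {r = r} r-involutive closed = (λ _ → closed) , λ y Ky → r y , closed Ky , r-involutive y

r₁-involutive : ∀ x → r₁ (r₁ x) ≡ x
r₁-involutive (x , y) = cong₂ _,_ (lemma x y) (ℤₚ.neg-involutive y)
  where
  lemma : ∀ x y → x + y + - y ≡ x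
  lemma = solve-∀

r₂-involutive : ∀ x → r₂ (r₂ x) ≡ x
r₂-involutive (x , y) = cong₂ _,_ (ℤₚ.neg-involutive x) (ℤₚ.neg-involutive y)

module _ {g a : ℕ} (g∣a : g ∣ a) where
  Sublattice⇒g∣y : ∀ {x y} → Sublattice g a (x , y) → + g ∣ℤ y
  Sublattice⇒g∣y {x} {y} (g∣x , a∣y-x) =
    subst (+ g ∣ℤ_) (lemma x y) (∣m∣n⇒∣m+n (Signed.∣-trans (∣ᵤ⇒∣ g∣a) a∣y-x) g∣x)
    where
    lemma : ∀ x y → y - x + x ≡ y
    lemma = solve-∀

  Sublattice-r₂ : Preserves r₂ (Sublattice g a)
  Sublattice-r₂ = involution⇒Preserves r₂-involutive λ { {x , y} L@(_ , a∣y-x) →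
    ∣m⇒∣-m (Sublattice⇒g∣y L) , subst (+ a ∣ℤ_) (lemma x y) a∣y-x }
    where
    lemma : ∀ x y → y - x ≡ - x - - y
    lemma = solve-∀

  Sublattice-r₁ : a ∣ 3 ℕ.* g → Preserves r₁ (Sublattice g a)
  Sublattice-r₁ a∣3g = involution⇒Preserves r₁-involutive λ { {x , y} L@(g∣x , a∣y-x) →
    ∣m∣n⇒∣m+n g∣x (Sublattice⇒g∣y L) ,
    subst (+ a ∣ℤ_) (lemma x y)
      (∣m⇒∣-m (∣m∣n⇒∣m+n (∣n⇒∣m*n (+ 2) a∣y-x)
                         (Signed.∣-trans (subst (+ a ∣ℤ_) (ℤₚ.pos-* 3 g) (∣ᵤ⇒∣ a∣3g)) (Signed.*-monoʳ-∣ (+ 3) g∣x)))) }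
    where
    lemma : ∀ x y → - (+ 2 * (y - x) + + 3 * x) ≡ - y - (x + y)
    lemma = solve-∀

module _ {K : SubsetΛ} (K-sub : IsSubgroup K) (ρ₁ : Preserves r₁ K) (ρ₂ : Preserves r₂ K) where
  open Subgroup K-sub

  reflection-constraints : ∀ {a} → (∀ x → K (x , 0ℤ) → a ∣ℤ x) →
                           ∀ {x y} → K (x , y) → a ∣ℤ y - x × a ∣ℤ + 3 * x
  reflection-constraints {a} axis {x} {y} K[x,y] =
    subst (a ∣ℤ_) (y-x≡ x y) (∣m⇒∣-m (∣m∣n⇒∣m+n a∣u a∣w)) ,
    subst (a ∣ℤ_) (3x≡ x y) (∣m∣n⇒∣m+n (∣n⇒∣m*n (+ 2) a∣u) a∣w)
    where
    a∣2x+y : ∀ {x y} → K (x , y) → a ∣ℤ x + (x + y)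
    a∣2x+y {x} {y} K[x,y] = axis _ (subst (λ z → K (x + (x + y) , z)) (ℤₚ.+-inverseʳ y)
                                       (closed+ K[x,y] (proj₁ ρ₁ _ K[x,y])))
    a∣u : a ∣ℤ x + (x + y)
    a∣u = a∣2x+y K[x,y]
    a∣w : a ∣ℤ (- y + - x) + ((- y + - x) + - - x)
    a∣w = a∣2x+y (proj₁ ρ₁ _ (proj₁ ρ₂ _ K[x,y]))
    y-x≡ : ∀ x y → - (x + (x + y) + ((- y + - x) + ((- y + - x) + - - x))) ≡ y - x
    y-x≡ = solve-∀
    3x≡ : ∀ x y → + 2 * (x + (x + y)) + ((- y + - x) + ((- y + - x) + - - x)) ≡ + 3 * x
    3x≡ = solve-∀

module _ {K : SubsetΛ} (K-sub : IsSubgroup K) {g a : ℕ}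
         (K[g,g] : K (+ g , + g)) (K[0,a] : K (0ℤ , + a))
         (diagonal : ∀ x → K (x , x) → + g ∣ℤ x) (a∣y-x : ∀ {x y} → K (x , y) → + a ∣ℤ y - x) where
  open Subgroup K-sub

  private
    shift-to-diagonal : ∀ x y q → y - x ≡ q * + a → (x , y) -Λ (q · (0ℤ , + a)) ≡ (x , x)
    shift-to-diagonal x y q y-x≡ = cong₂ _,_ (lemma₁ x q) (begin
      y - q * + a   ≡⟨ cong (λ d → y - d) y-x≡ ⟨
      y - (y - x)   ≡⟨ lemma₂ x y ⟩
      x             ∎)
      where
      open ≡-Reasoning
      lemma₁ : ∀ x q → x - q * 0ℤ ≡ x
      lemma₁ = solve-∀
      lemma₂ : ∀ x y → y - (y - x) ≡ x
      lemma₂ = solve-∀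

    combination : ∀ x y p q → x ≡ p * + g → y - x ≡ q * + a → (p · (+ g , + g)) +Λ (q · (0ℤ , + a)) ≡ (x , y)
    combination x y p q x≡ y-x≡ = cong₂ _,_ (trans (lemma₁ p q (+ g)) (sym x≡)) (begin
      p * + g + q * + a   ≡⟨ cong₂ _+_ x≡ y-x≡ ⟨
      x + (y - x)         ≡⟨ lemma₂ x y ⟩
      y                   ∎)
      where
      open ≡-Reasoning
      lemma₁ : ∀ p q G → p * G + q * 0ℤ ≡ p * G
      lemma₁ = solve-∀
      lemma₂ : ∀ x y → x + (y - x) ≡ y
      lemma₂ = solve-∀

  ≐Sublattice : K ≐ Sublattice g a
  ≐Sublattice (x , y) = mk⇔ to from
    where
    to : K (x , y) → Sublattice g a (x , y)
    to K[x,y] with a∣y-x K[x,y]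
    ... | a∣ @ (Signed.divides q y-x≡) =
      diagonal x (subst K (shift-to-diagonal x y q y-x≡) (closed-- K[x,y] (closed-· q K[0,a]))) , a∣
    from : Sublattice g a (x , y) → K (x , y)
    from (Signed.divides p x≡ , Signed.divides q y-x≡) =
      subst K (combination x y p q x≡ y-x≡) (closed+ (closed-· p K[g,g]) (closed-· q K[0,a]))

g*[t*g]≡t*[g*g] : ∀ g t → g ℕ.* (t ℕ.* g) ≡ t ℕ.* (g ℕ.* g)
g*[t*g]≡t*[g*g] = ℕ-solve-∀

∣∧∣3*⇒≡t* : ∀ {g a} → .{{NonZero g}} → g ∣ a → a ∣ 3 ℕ.* g → ∃ λ t → t ∣ 3 × a ≡ t ℕ.* g
∣∧∣3*⇒≡t* {g} (divides t refl) tg∣3g = t , ℕ∣.*-cancelʳ-∣ g tg∣3g , refl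

module _ {K : SubsetΛ} (K-sub : IsSubgroup K) (ρ₁ : Preserves r₁ K) (ρ₂ : Preserves r₂ K)
         {a g : ℕ} .{{_ : NonZero a}} .{{_ : NonZero g}}
         (K[a,0] : K (+ a , 0ℤ)) (axis : ∀ x → K (x , 0ℤ) → + a ∣ℤ x)
         (K[g,g] : K (+ g , + g)) (diagonal : ∀ x → K (x , x) → + g ∣ℤ x) where
  open Subgroup K-sub

  private
    K[0,a] : K (0ℤ , + a)
    K[0,a] = subst K (cong₂ _,_ refl (ℤₚ.neg-involutive (+ a))) (closed- (proj₁ ρ₂ _ K[a,0]))

    K[a,a] : K (+ a , + a)
    K[a,a] = subst K (cong (_, + a) (ℤₚ.+-identityʳ (+ a))) (closed+ K[a,0] K[0,a])

    constraints : ∀ {x y} → K (x , y) → + a ∣ℤ y - x × + a ∣ℤ + 3 * x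
    constraints = reflection-constraints K-sub ρ₁ ρ₂ axis

    K≐L : K ≐ Sublattice g a
    K≐L = ≐Sublattice K-sub K[g,g] K[0,a] diagonal (proj₁ ∘ constraints)

    g∣a : g ∣ a
    g∣a = ∣⇒∣ᵤ (diagonal (+ a) K[a,a])

    a∣3g : a ∣ 3 ℕ.* g
    a∣3g = subst (λ z → a ∣ ℤ.∣ z ∣) (sym (ℤₚ.pos-* 3 g)) (∣⇒∣ᵤ (proj₂ (constraints K[g,g])))

  invariant-classification : ∀ {n} → HasIndex K n →
    ∃ λ t → t ∣ 3 × n ≡ t ℕ.* (g ℕ.* g) × K ≐ Sublattice g (t ℕ.* g)
  invariant-classification {n} K-idx with ∣∧∣3*⇒≡t* g∣a a∣3g
  ... | t , t∣3 , a≡tg = t , t∣3 , n≡ , subst (λ a → K ≐ Sublattice g a) a≡tg K≐L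
    where
    n≡ : n ≡ t ℕ.* (g ℕ.* g)
    n≡ = begin
      n               ≡⟨ index-unique (Sublattice-subgroup g a) (HasIndex-resp-≐ K≐L K-idx) (Sublattice-index g a) ⟩
      g ℕ.* a         ≡⟨ cong (g ℕ.*_) a≡tg ⟩
      g ℕ.* (t ℕ.* g) ≡⟨ g*[t*g]≡t*[g*g] g t ⟩
      t ℕ.* (g ℕ.* g) ∎
      where open ≡-Reasoning

·-e₁ : ∀ m → m · (1ℤ , 0ℤ) ≡ (m , 0ℤ)
·-e₁ m = cong₂ _,_ (ℤₚ.*-identityʳ m) (ℤₚ.*-zeroʳ m)

·-e₁₁ : ∀ m → m · (1ℤ , 1ℤ) ≡ (m , m)
·-e₁₁ m = cong₂ _,_ (ℤₚ.*-identityʳ m) (ℤₚ.*-identityʳ m)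

SublatticeForm : ℕ → SubsetΛ → Set
SublatticeForm n K = ∃₂ λ g t → t ∣ 3 × n ≡ t ℕ.* (g ℕ.* g) × K ≐ Sublattice g (t ℕ.* g)

counted⇒SublatticeForm : ∀ {n K} → Counted n K → SublatticeForm n K
counted⇒SublatticeForm {n} {K} (K-sub , K-idx , ρ₁ , ρ₂) =
  classify (order K-sub K-idx (1ℤ , 0ℤ)) (order K-sub K-idx (1ℤ , 1ℤ))
  where
  -- Matching on `order` with `with` would make Agda evaluate its pigeonhole search.
  classify : ∃ (OrderOf K (1ℤ , 0ℤ)) → ∃ (OrderOf K (1ℤ , 1ℤ)) → SublatticeForm n K
  classify (a₀ , K[a·e₁] , ∣axis) (g₀ , K[g·e₁₁] , ∣diagonal) =
    suc g₀ , invariant-classification K-sub ρ₁ ρ₂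
      (subst K (·-e₁ _) K[a·e₁]) (λ x K[x,0] → ∣axis x (subst K (sym (·-e₁ x)) K[x,0]))
      (subst K (·-e₁₁ _) K[g·e₁₁]) (λ x K[x,x] → ∣diagonal x (subst K (sym (·-e₁₁ x)) K[x,x]))
      K-idx

SublatticeForm⇒¬BadN : ∀ {n K} → SublatticeForm n K → ¬ BadN n
SublatticeForm⇒¬BadN (g , t , t∣3 , refl , _) = ¬BadN[t*D²] t∣3 g

SublatticeForm⇒≐ : ∀ {t D K} → .{{NonZero D}} → t ∣ 3 →
                   SublatticeForm (t ℕ.* (D ℕ.* D)) K → K ≐ Sublattice D (t ℕ.* D)
SublatticeForm⇒≐ t∣3 (g , t′ , t′∣3 , n≡ , K≐) with t*D²-injective {E = g} t∣3 t′∣3 n≡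
... | refl , refl = K≐

Sublattice-counted : ∀ {t g} → t ∣ 3 → .{{NonZero g}} →
                     Counted (t ℕ.* (g ℕ.* g)) (Sublattice g (t ℕ.* g))
Sublattice-counted {t} {g} t∣3 =
  Sublattice-subgroup g (t ℕ.* g) ,
  subst (HasIndex (Sublattice g (t ℕ.* g))) (g*[t*g]≡t*[g*g] g t) (Sublattice-index g (t ℕ.* g)) ,
  Sublattice-r₁ (ℕ∣.n∣m*n t) (ℕ∣.*-monoˡ-∣ g t∣3) ,
  Sublattice-r₂ (ℕ∣.n∣m*n t)
  where
  instance
    t≢0 : NonZero t
    t≢0 = ℕ.≢-nonZero λ { refl → case ℕ∣.0∣⇒≡0 t∣3 of λ () }
    tg≢0 : NonZero (t ℕ.* g)
    tg≢0 = ℕₚ.m*n≢0 t g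

BadN⇒CountIs0 : ∀ {n} → BadN n → CountIs (Counted n) 0
BadN⇒CountIs0 bad = (λ ()) , (λ ()) , (λ ()) , λ K K-counted →
  ⊥-elim (SublatticeForm⇒¬BadN (counted⇒SublatticeForm K-counted) bad)

SquareOrThriceSquare⇒CountIs1 : ∀ {n} → .{{NonZero n}} → SquareOrThriceSquare n → CountIs (Counted n) 1
SquareOrThriceSquare⇒CountIs1 (t , D , t∣3 , refl) =
  (λ _ → Sublattice D (t ℕ.* D)) ,
  (λ _ → Sublattice-counted t∣3 ⦃ D≢0 ⦄) ,
  (λ { Fin.zero Fin.zero _ → refl }) ,
  λ K K-counted → Fin.zero , SublatticeForm⇒≐ ⦃ D≢0 ⦄ t∣3 (counted⇒SublatticeForm K-counted)
  where
  D≢0 : NonZero D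
  D≢0 = ℕₚ.m*n≢0⇒m≢0 D ⦃ ℕₚ.m*n≢0⇒n≢0 t ⦄

lemma2 : (n : ℕ) → .{{_ : NonZero n}} →
           (BadN n → CountIs (Counted n) 0) × (¬ BadN n → CountIs (Counted n) 1)
lemma2 n = BadN⇒CountIs0 , λ ¬bad → SquareOrThriceSquare⇒CountIs1 (¬BadN⇒SquareOrThriceSquare n ¬bad)
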